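{- Let $t\ge5$ and $n\ge t$ be integers, and let $S_t$ be the star on $t$ vertices. Then $\mathrm{sat}(n,\mathcal{B}(S_t))=t-1=|E(S_t)|$.
   Context: Hypergraphs are pairs $(V,E)$ where $E$ is a set of distinct subsets of $V$ (hyperedges), each of size at least $2$. For a graph $G$, a hypergraph $H$ is Berge-$G$ if there is a hypergraph $H'$ isomorphic to $H$ with $V(G)\subseteq V(H')$ and a bijection $\phi:E(G)\to E(H')$ with $e\subseteq\phi(e)$ for every $e\in E(G)$. $\mathcal{B}(G)$ denotes the set of all Berge-$G$ hypergraphs. A hypergraph $\mathcal{H}$ is $\mathcal{B}(G)$ saturated if it contains no subhypergraph isomorphic to a member of $\mathcal{B}(G)$, but adding to $\mathcal{H}$ any new hyperedge (a subset of the vertex set of size at least $2$ not already a hyperedge) creates such a subhypergraph. For $n\ge|V(G)|$, $\mathrm{sat}(n,\mathcal{B}(G))$ is the minimum number of hyperedges of a $\mathcal{B}(G)$ saturated hypergraph on $n$ vertices. -}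

module Defs where

open import Data.Nat using (ℕ; zero; suc; _≤_)
open import Data.Fin using (Fin; zero; suc)
open import Data.Fin.Subset using (Subset; _∈_; ∣_∣)
open import Data.List using (List; length; lookup; _∷_)
open import Data.List.Membership.Propositional using () renaming (_∈_ to _∈ₗ_)
open import Data.List.Relation.Unary.All using (All)
open import Data.List.Relation.Unary.Unique.Propositional using (Unique)
open import Data.Product using (Σ; _×_; _,_; proj₁; proj₂)
open import Function.Definitions using (Injective)
open import Relation.Binary.PropositionalEquality using (_≡_)
open import Relation.Nullary using (¬_)

record Graph : Set where
  field
    V    : ℕ
    E    : ℕ
    ends : Fin E → Fin V × Fin V

star : ℕ → Graph
star zero    = record { V = zero ; E = zero ; ends = λ () }
star (suc s) = record { V = suc s ; E = s ; ends = λ i → zero , suc i }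

record Hypergraph (n : ℕ) : Set where
  field
    edges  : List (Subset n)
    unique : Unique edges
    big    : All (λ e → 2 ≤ ∣ e ∣) edges

-- The list of hyperedges L contains a sub-hypergraph isomorphic to a Berge-G
-- hypergraph: an injective vertex map f : V(G) → Fin n and an injective
-- edge map φ : E(G) → hyperedges of L with e ⊆ φ(e) (after embedding by f).
ContainsBerge : (G : Graph) {n : ℕ} → List (Subset n) → Set
ContainsBerge G {n} L =
  Σ (Fin (Graph.V G) → Fin n) λ f → Injective _≡_ _≡_ f ×
  Σ (Fin (Graph.E G) → Fin (length L)) λ φ → Injective _≡_ _≡_ φ ×
  ((e : Fin (Graph.E G)) →
     f (proj₁ (Graph.ends G e)) ∈ lookup L (φ e) ×
     f (proj₂ (Graph.ends G e)) ∈ lookup L (φ e))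

Saturated : (G : Graph) {n : ℕ} → Hypergraph n → Set
Saturated G {n} H =
  ¬ ContainsBerge G (Hypergraph.edges H) ×
  ((s : Subset n) → 2 ≤ ∣ s ∣ → ¬ (s ∈ₗ Hypergraph.edges H) →
     ContainsBerge G (s ∷ Hypergraph.edges H))

SatNumberIs : (n : ℕ) → Graph → ℕ → Set
SatNumberIs n G k =
  Σ (Hypergraph n) (λ H → Saturated G H × length (Hypergraph.edges H) ≡ k) ×
  ((H : Hypergraph n) → Saturated G H → k ≤ length (Hypergraph.edges H))

-- Write t = r + 2.  Upper bound: sort the vertices into the r + 1 classes {0}, …, {r − 1},
-- {r, …, n − 1} and take as hyperedges the complements of the classes.  No vertex lies in all of them,
-- so there is no Berge star with r + 1 edges; a new hyperedge X ∋ v, w extends, by the leaf w, a star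
-- centred at v whose r edges are the hyperedges containing v, with leaves chosen among the first r
-- numbers other than v, w by a cyclic shift so that no leaf lies in the class its hyperedge misses.
--
-- Lower bound: in a saturated hypergraph with fewer than s = t − 1 hyperedges, adding a missing pair
-- {0, i} creates a Berge star using every hyperedge, so there are s − 1 ≥ 3 of them and they share a
-- vertex.  Three distinct sets have two vertices a, b outside their common intersection; the pair
-- {a, b} is then new, yet adding it would force a star centre in {a, b} lying in every hyperedge.

module Submission where

open import Defs
open import Data.Nat using (ℕ; zero; suc; pred; _+_; _≤_; _<_; _∸_; _⊓_; z≤n; s≤s; _≟_; _<?_)
import Data.Nat.Properties as ℕ
open import Data.Fin using (Fin; zero; suc; toℕ; fromℕ<; cast; punchOut)
import Data.Fin.Properties as Fin
open import Data.Fin.Subset using (Subset; _∈_; ∣_∣; inside; outside; ⁅_⁆; _∪_)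
import Data.Fin.Subset.Properties as Subset
open import Data.Fin.Subset.Properties using (∣p∣≤∣x∷p∣; x∈⁅x⁆; x∈⁅y⁆⇒x≡y; x∈p∪q⁻; p⊆p∪q; q⊆p∪q)
open import Data.Bool using (Bool; true; false; not)
import Data.Bool as Bool
open import Data.Bool.Properties using (T-≡)
open import Data.Vec using (_∷_; here; there; lookup; tabulate)
import Data.Vec.Properties as Vec
open import Data.List using (List; []; _∷_; length)
import Data.List as List
import Data.List.Properties as List
open import Data.List.Membership.Propositional using () renaming (_∈_ to _∈ₗ_; _∉_ to _∉ₗ_)
import Data.List.Membership.DecPropositional as DecMembership
open import Data.List.Relation.Unary.All as All using (All; _∷_)
import Data.List.Relation.Unary.All.Properties as All
open import Data.List.Relation.Unary.Any using (index)
open import Data.List.Relation.Unary.Any.Properties using (lookup-index)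
open import Data.List.Relation.Unary.AllPairs using (_∷_)
open import Data.List.Relation.Unary.Unique.Propositional using (Unique)
import Data.List.Relation.Unary.Unique.Propositional.Properties as Unique
open import Data.Product using (∃; ∃₂; _×_; _,_; proj₁; proj₂)
open import Data.Sum using (_⊎_; inj₁; inj₂; [_,_]′)
import Data.Sum as Sum
open import Data.Empty using (⊥; ⊥-elim)
open import Function using (_∘_)
open import Function.Bundles using (Equivalence)
open import Function.Definitions using (Injective)
open import Relation.Binary.PropositionalEquality using (_≡_; _≢_; refl; sym; trans; cong; subst)
open import Relation.Nullary using (¬_; Dec; yes; no)
open import Relation.Nullary.Decidable using (⌊_⌋; _×-dec_; _→-dec_; ¬?; fromWitnessFalse; toWitnessFalse)

private variable
  n s : ℕ

x∈p⇒1≤∣p∣ : ∀ {p : Subset n} {x} → x ∈ p → 1 ≤ ∣ p ∣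
x∈p⇒1≤∣p∣ {p = inside ∷ p} here      = s≤s z≤n
x∈p⇒1≤∣p∣ {p = b ∷ p}      (there x∈p) = ℕ.≤-trans (x∈p⇒1≤∣p∣ x∈p) (∣p∣≤∣x∷p∣ b p)

1≤∣p∣⇒nonempty : ∀ {p : Subset n} → 1 ≤ ∣ p ∣ → ∃ (_∈ p)
1≤∣p∣⇒nonempty {p = inside ∷ p}  _ = zero , here
1≤∣p∣⇒nonempty {p = outside ∷ p} h with x , x∈p ← 1≤∣p∣⇒nonempty {p = p} h = suc x , there x∈p

x≢y⇒2≤∣p∣ : ∀ {p : Subset n} {x y} → x ≢ y → x ∈ p → y ∈ p → 2 ≤ ∣ p ∣
x≢y⇒2≤∣p∣ {x = zero}  {zero}  x≢y here      here       = ⊥-elim (x≢y refl)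
x≢y⇒2≤∣p∣ {x = zero}  {suc y} _   here      (there y∈p) = s≤s (x∈p⇒1≤∣p∣ y∈p)
x≢y⇒2≤∣p∣ {x = suc x} {zero}  _   (there x∈p) here      = s≤s (x∈p⇒1≤∣p∣ x∈p)
x≢y⇒2≤∣p∣ {p = b ∷ p} {suc x} {suc y} x≢y (there x∈p) (there y∈p) =
  ℕ.≤-trans (x≢y⇒2≤∣p∣ (x≢y ∘ cong suc) x∈p y∈p) (∣p∣≤∣x∷p∣ b p)

2≤∣p∣⇒distinct-members : ∀ {p : Subset n} → 2 ≤ ∣ p ∣ → ∃₂ λ x y → x ≢ y × x ∈ p × y ∈ p
2≤∣p∣⇒distinct-members {p = inside ∷ p} (s≤s h) with y , y∈p ← 1≤∣p∣⇒nonempty {p = p} h =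
  zero , suc y , (λ ()) , here , there y∈p
2≤∣p∣⇒distinct-members {p = outside ∷ p} h with x , y , x≢y , x∈p , y∈p ← 2≤∣p∣⇒distinct-members {p = p} h =
  suc x , suc y , x≢y ∘ Fin.suc-injective , there x∈p , there y∈p

pair : Fin n → Fin n → Subset n
pair x y = ⁅ x ⁆ ∪ ⁅ y ⁆

x∈pair : (x y : Fin n) → x ∈ pair x y
x∈pair x y = p⊆p∪q ⁅ y ⁆ (x∈⁅x⁆ x)

y∈pair : (x y : Fin n) → y ∈ pair x y
y∈pair x y = q⊆p∪q ⁅ x ⁆ ⁅ y ⁆ (x∈⁅x⁆ y)

∈pair⁻ : ∀ {x y z : Fin n} → z ∈ pair x y → z ≡ x ⊎ z ≡ y
∈pair⁻ {x = x} {y} z∈ with x∈p∪q⁻ ⁅ x ⁆ ⁅ y ⁆ z∈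
... | inj₁ z∈x = inj₁ (x∈⁅y⁆⇒x≡y x z∈x)
... | inj₂ z∈y = inj₂ (x∈⁅y⁆⇒x≡y y z∈y)

2≤∣pair∣ : ∀ {x y : Fin n} → x ≢ y → 2 ≤ ∣ pair x y ∣
2≤∣pair∣ {x = x} {y} x≢y = x≢y⇒2≤∣p∣ x≢y (x∈pair x y) (y∈pair x y)

-- If some k were missed, punching it out would inject Fin a into Fin (b - 1).
injective⇒surjective : ∀ {a b} {f : Fin a → Fin b} → Injective _≡_ _≡_ f → b ≤ a → ∀ k → ∃ λ i → f i ≡ k
injective⇒surjective {a} {suc b} {f} f-inj b≤a k with Fin.any? (λ i → f i Fin.≟ k)
... | yes hit = hit
... | no miss = ⊥-elim (ℕ.<-irrefl refl (ℕ.≤-trans b≤a (Fin.injective⇒≤ g-inj)))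
  where
  g : Fin a → Fin b
  g i = punchOut {i = k} (λ k≡fi → miss (i , sym k≡fi))
  g-inj : Injective _≡_ _≡_ g
  g-inj {i} {j} = f-inj ∘ Fin.punchOut-injective (λ k≡fi → miss (i , sym k≡fi)) (λ k≡fj → miss (j , sym k≡fj))

lookup-All : ∀ {a p} {A : Set a} {P : A → Set p} (xs : List A) → (∀ k → P (List.lookup xs k)) → All P xs
lookup-All {P = P} xs Pxs = All.tabulate λ x∈xs → subst P (sym (lookup-index x∈xs)) (Pxs (index x∈xs))

record BergeStar (s : ℕ) (L : List (Subset n)) : Set where
  field
    centre              : Fin n
    leaf                : Fin s → Fin n
    hyperedge           : Fin s → Fin (length L)
    leaf-injective      : Injective _≡_ _≡_ leaf
    leaf≢centre         : ∀ i → leaf i ≢ centre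
    hyperedge-injective : Injective _≡_ _≡_ hyperedge
    centre∈hyperedge    : ∀ i → centre ∈ List.lookup L (hyperedge i)
    leaf∈hyperedge      : ∀ i → leaf i ∈ List.lookup L (hyperedge i)

BergeStar⇒ContainsBerge : ∀ {L : List (Subset n)} → BergeStar s L → ContainsBerge (star (suc s)) L
BergeStar⇒ContainsBerge S = vertex , vertex-injective , hyperedge , hyperedge-injective ,
                              λ i → centre∈hyperedge i , leaf∈hyperedge i
  where
  open BergeStar S
  vertex : Fin (suc _) → Fin _
  vertex zero    = centre
  vertex (suc i) = leaf i
  vertex-injective : Injective _≡_ _≡_ vertex
  vertex-injective {zero}  {zero}  _  = refl
  vertex-injective {zero}  {suc j} eq = ⊥-elim (leaf≢centre j (sym eq))
  vertex-injective {suc i} {zero}  eq = ⊥-elim (leaf≢centre i eq)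
  vertex-injective {suc i} {suc j} eq = cong suc (leaf-injective eq)

BergeStar-∷ : ∀ {L : List (Subset n)} {X w} (S : BergeStar s L) → let open BergeStar S in
  centre ∈ X → w ∈ X → w ≢ centre → (∀ i → leaf i ≢ w) → BergeStar (suc s) (X ∷ L)
BergeStar-∷ {w = w} S c∈X w∈X w≢c leaf≢w = record
  { centre              = centre
  ; leaf                = λ { zero → w ; (suc i) → leaf i }
  ; hyperedge           = λ { zero → zero ; (suc i) → suc (hyperedge i) }
  ; leaf-injective      = λ { {zero} {zero} _ → refl
                            ; {zero} {suc j} eq → ⊥-elim (leaf≢w j (sym eq))
                            ; {suc i} {zero} eq → ⊥-elim (leaf≢w i eq)
                            ; {suc i} {suc j} eq → cong suc (leaf-injective eq) }
  ; leaf≢centre         = λ { zero → w≢c ; (suc i) → leaf≢centre i }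
  ; hyperedge-injective = λ { {zero} {zero} _ → refl
                            ; {suc i} {suc j} eq → cong suc (hyperedge-injective (Fin.suc-injective eq)) }
  ; centre∈hyperedge    = λ { zero → c∈X ; (suc i) → centre∈hyperedge i }
  ; leaf∈hyperedge      = λ { zero → w∈X ; (suc i) → leaf∈hyperedge i }
  }
  where open BergeStar S

ContainsBerge⇒≤length : ∀ {L : List (Subset n)} → ContainsBerge (star (suc s)) L → s ≤ length L
ContainsBerge⇒≤length (_ , _ , _ , φ-injective , _) = Fin.injective⇒≤ φ-injective

-- With at most s hyperedges, the s hyperedges of a Berge star are all of them.
ContainsBerge⇒common-vertex : ∀ {L : List (Subset n)} → length L ≤ s →
  ContainsBerge (star (suc s)) L → ∃ λ c → All (c ∈_) L
ContainsBerge⇒common-vertex {L = L} L≤s (f , _ , φ , φ-injective , ends∈) =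
  f zero , lookup-All L centre∈
  where
  centre∈ : ∀ k → f zero ∈ List.lookup L k
  centre∈ k with i , refl ← injective⇒surjective φ-injective L≤s k = proj₁ (ends∈ i)

Saturating : ℕ → List (Subset n) → Set
Saturating {n} s L = (X : Subset n) → 2 ≤ ∣ X ∣ → X ∉ₗ L → ContainsBerge (star (suc s)) (X ∷ L)

lookup-ext : ∀ {P Q : Subset n} → (∀ y → lookup P y ≡ lookup Q y) → P ≡ Q
lookup-ext {P = P} {Q} eq = trans (sym (Vec.tabulate∘lookup P)) (trans (Vec.tabulate-cong eq) (Vec.tabulate∘lookup Q))

full-except⇒≡ : ∀ {P Q : Subset n} a → (∀ y → y ≢ a → y ∈ P) → (∀ y → y ≢ a → y ∈ Q) →
  lookup P a ≡ lookup Q a → P ≡ Q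
full-except⇒≡ a y∈P y∈Q at-a = lookup-ext pointwise
  where
  pointwise : ∀ y → _
  pointwise y with y Fin.≟ a
  ... | yes refl = at-a
  ... | no y≢a   = trans (Vec.[]=⇒lookup (y∈P y y≢a)) (sym (Vec.[]=⇒lookup (y∈Q y y≢a)))

bool-pigeonhole : (x y z : Bool) → x ≡ y ⊎ x ≡ z ⊎ y ≡ z
bool-pigeonhole false false _     = inj₁ refl
bool-pigeonhole true  true  _     = inj₁ refl
bool-pigeonhole false true  false = inj₂ (inj₁ refl)
bool-pigeonhole true  false true  = inj₂ (inj₁ refl)
bool-pigeonhole false true  true  = inj₂ (inj₂ refl)
bool-pigeonhole true  false false = inj₂ (inj₂ refl)

module _ (E₁ E₂ E₃ : Subset n) where

  Common : Fin n → Set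
  Common x = x ∈ E₁ × x ∈ E₂ × x ∈ E₃

  full-except⇒two-equal : ∀ a → (∀ y → y ≢ a → Common y) → E₁ ≡ E₂ ⊎ E₁ ≡ E₃ ⊎ E₂ ≡ E₃
  full-except⇒two-equal a common =
    Sum.map (full-except⇒≡ a full₁ full₂)
            (Sum.map (full-except⇒≡ a full₁ full₃) (full-except⇒≡ a full₂ full₃))
      (bool-pigeonhole (lookup E₁ a) (lookup E₂ a) (lookup E₃ a))
    where
    full₁ : ∀ y → y ≢ a → y ∈ E₁
    full₁ y = proj₁ ∘ common y
    full₂ : ∀ y → y ≢ a → y ∈ E₂
    full₂ y = proj₁ ∘ proj₂ ∘ common y
    full₃ : ∀ y → y ≢ a → y ∈ E₃
    full₃ y = proj₂ ∘ proj₂ ∘ common y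

  distinct⇒uncommon-pair : E₁ ≢ E₂ → E₁ ≢ E₃ → E₂ ≢ E₃ → ∃₂ λ a b → b ≢ a × ¬ Common a × ¬ Common b
  distinct⇒uncommon-pair E₁≢E₂ E₁≢E₃ E₂≢E₃ = a , b , b≢a , ¬common-a , ¬common-b
    where
    common? : ∀ x → Dec (Common x)
    common? x = (x Subset.∈? E₁) ×-dec (x Subset.∈? E₂) ×-dec (x Subset.∈? E₃)
    E₁≠E₂-at : ∃ λ a → lookup E₁ a ≢ lookup E₂ a
    E₁≠E₂-at = Fin.¬∀⟶∃¬ _ _ (λ a → lookup E₁ a Bool.≟ lookup E₂ a) (E₁≢E₂ ∘ lookup-ext)
    a = proj₁ E₁≠E₂-at
    ¬common-a : ¬ Common a
    ¬common-a (a∈E₁ , a∈E₂ , _) = proj₂ E₁≠E₂-at (trans (Vec.[]=⇒lookup a∈E₁) (sym (Vec.[]=⇒lookup a∈E₂)))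
    another : ∃ λ b → ¬ (b ≢ a → Common b)
    another = Fin.¬∀⟶∃¬ _ _ (λ y → ¬? (y Fin.≟ a) →-dec common? y) λ common →
      [ E₁≢E₂ , [ E₁≢E₃ , E₂≢E₃ ]′ ]′ (full-except⇒two-equal a common)
    b = proj₁ another
    b≢a : b ≢ a
    b≢a b≡a = proj₂ another λ b≢a′ → ⊥-elim (b≢a′ b≡a)
    ¬common-b : ¬ Common b
    ¬common-b common-b = proj₂ another λ _ → common-b

saturating⇒¬common-vertex : ∀ {L : List (Subset n)} → Unique L → Saturating s L →
  3 ≤ length L → length L < s → ∃ (λ c → All (c ∈_) L) → ⊥
saturating⇒¬common-vertex {L = []}         _ _ ()                 _ _
saturating⇒¬common-vertex {L = _ ∷ []}     _ _ (s≤s ())           _ _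
saturating⇒¬common-vertex {L = _ ∷ _ ∷ []} _ _ (s≤s (s≤s ()))     _ _
saturating⇒¬common-vertex {L = E₁ ∷ E₂ ∷ E₃ ∷ R} ((E₁≢E₂ ∷ E₁≢E₃ ∷ _) ∷ (E₂≢E₃ ∷ _) ∷ _)
                          saturating _ L<s (_ , c∈L)
  with a , b , b≢a , ¬common-a , ¬common-b ← distinct⇒uncommon-pair E₁ E₂ E₃ E₁≢E₂ E₁≢E₃ E₂≢E₃
  = no-common-vertex-in-pair (All.head new-centre∈) (All.tail new-centre∈)
  where
  no-common-vertex-in-pair : ∀ {x} → x ∈ pair a b → All (x ∈_) (E₁ ∷ E₂ ∷ E₃ ∷ R) → ⊥
  no-common-vertex-in-pair x∈ab (x∈E₁ ∷ x∈E₂ ∷ x∈E₃ ∷ _) with ∈pair⁻ x∈ab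
  ... | inj₁ refl = ¬common-a (x∈E₁ , x∈E₂ , x∈E₃)
  ... | inj₂ refl = ¬common-b (x∈E₁ , x∈E₂ , x∈E₃)
  pair∉L : pair a b ∉ₗ E₁ ∷ E₂ ∷ E₃ ∷ R
  pair∉L pair∈L = no-common-vertex-in-pair (All.lookup c∈L pair∈L) c∈L
  new-centre∈ : All (_ ∈_) (pair a b ∷ E₁ ∷ E₂ ∷ E₃ ∷ R)
  new-centre∈ = proj₂ (ContainsBerge⇒common-vertex L<s (saturating (pair a b) (2≤∣pair∣ (b≢a ∘ sym)) pair∉L))

spoke : ∀ {m} → Fin m → Subset (suc m)
spoke i = pair zero (suc i)

2≤∣spoke∣ : ∀ {m} (i : Fin m) → 2 ≤ ∣ spoke i ∣
2≤∣spoke∣ i = 2≤∣pair∣ {x = zero} {y = suc i} λ ()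

spoke-injective : ∀ {m} → Injective _≡_ _≡_ (spoke {m})
spoke-injective {x = i} eq with ∈pair⁻ {x = zero} (subst (suc i ∈_) eq (y∈pair zero (suc i)))
... | inj₂ suc-i≡suc-j = Fin.suc-injective suc-i≡suc-j

unlisted-spoke : ∀ {m} (L : List (Subset (suc m))) → length L < m → ∃ λ i → spoke i ∉ₗ L
unlisted-spoke L L<m = Fin.¬∀⟶∃¬ _ _ (λ i → spoke i ∈? L) all-listed⇒m≤length
  where
  open DecMembership (Vec.≡-dec Bool._≟_) using (_∈?_)
  all-listed⇒m≤length : ¬ (∀ i → spoke i ∈ₗ L)
  all-listed⇒m≤length listed = ℕ.<⇒≱ L<m (Fin.injective⇒≤ position-injective)
    where
    position-injective : Injective _≡_ _≡_ (index ∘ listed)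
    position-injective {i} {j} eq = spoke-injective
      (trans (lookup-index (listed i)) (trans (cong (List.lookup L) eq) (sym (lookup-index (listed j)))))

saturated⇒≤length : 4 ≤ s → s < n → (H : Hypergraph n) → Saturated (star (suc s)) H →
  s ≤ length (Hypergraph.edges H)
saturated⇒≤length {s} {suc _} 4≤s s<n H (_ , saturating) = ℕ.≮⇒≥ short⇒⊥
  where
  open Hypergraph H using (edges; unique)
  short⇒⊥ : length edges < s → ⊥
  short⇒⊥ L<s = saturating⇒¬common-vertex unique saturating 3≤length L<s
    (proj₁ centre , All.tail (proj₂ centre))
    where
    unlisted = unlisted-spoke edges (ℕ.<-≤-trans L<s (ℕ.≤-pred s<n))
    B = saturating (spoke (proj₁ unlisted)) (2≤∣spoke∣ (proj₁ unlisted)) (proj₂ unlisted)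
    centre = ContainsBerge⇒common-vertex L<s B
    3≤length : 3 ≤ length edges
    3≤length = ℕ.≤-pred (ℕ.≤-trans 4≤s (ContainsBerge⇒≤length B))

-- skip a y is the y-th element of ℕ ∖ {a} (Fin.punchIn on ℕ) and unskip a its inverse on ℕ ∖ {a};
-- skip₂ v w enumerates ℕ ∖ {v, w}.
skip : ℕ → ℕ → ℕ
skip zero    y       = suc y
skip (suc a) zero    = zero
skip (suc a) (suc y) = suc (skip a y)

unskip : ℕ → ℕ → ℕ
unskip zero    y       = pred y
unskip (suc a) zero    = zero
unskip (suc a) (suc y) = suc (unskip a y)

skip-≢ : ∀ a y → skip a y ≢ a
skip-≢ (suc a) (suc y) = skip-≢ a y ∘ ℕ.suc-injective

skip-injective : ∀ a {x y} → skip a x ≡ skip a y → x ≡ y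
skip-injective zero    eq = ℕ.suc-injective eq
skip-injective (suc a) {zero}  {zero}  _  = refl
skip-injective (suc a) {suc x} {suc y} eq = cong suc (skip-injective a (ℕ.suc-injective eq))

skip-unskip : ∀ a y → y ≢ a → skip a (unskip a y) ≡ y
skip-unskip zero    zero    y≢a = ⊥-elim (y≢a refl)
skip-unskip zero    (suc y) _   = refl
skip-unskip (suc a) zero    _   = refl
skip-unskip (suc a) (suc y) y≢a = cong suc (skip-unskip a y (y≢a ∘ cong suc))

y≤skip : ∀ a y → y ≤ skip a y
y≤skip zero    y       = ℕ.n≤1+n y
y≤skip (suc a) zero    = z≤n
y≤skip (suc a) (suc y) = s≤s (y≤skip a y)

skip≤1+y : ∀ a y → skip a y ≤ suc y
skip≤1+y zero    y       = ℕ.≤-refl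
skip≤1+y (suc a) zero    = z≤n
skip≤1+y (suc a) (suc y) = s≤s (skip≤1+y a y)

a≤y⇒skip≡1+y : ∀ {a y} → a ≤ y → skip a y ≡ suc y
a≤y⇒skip≡1+y {zero}          _         = refl
a≤y⇒skip≡1+y {suc a} {suc y} (s≤s a≤y) = cong suc (a≤y⇒skip≡1+y a≤y)

y<a⇒skip≡y : ∀ {a y} → y < a → skip a y ≡ y
y<a⇒skip≡y {suc a} {zero}  _         = refl
y<a⇒skip≡y {suc a} {suc y} (s≤s y<a) = cong suc (y<a⇒skip≡y y<a)

skip₂ : ℕ → ℕ → ℕ → ℕ
skip₂ v w k = skip v (skip (unskip v w) k)

skip₂-injective : ∀ v w {x y} → skip₂ v w x ≡ skip₂ v w y → x ≡ y
skip₂-injective v w = skip-injective (unskip v w) ∘ skip-injective v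

skip₂≢v : ∀ v w k → skip₂ v w k ≢ v
skip₂≢v v w k = skip-≢ v _

skip₂≢w : ∀ {v w} → w ≢ v → ∀ k → skip₂ v w k ≢ w
skip₂≢w {v} {w} w≢v k eq = skip-≢ (unskip v w) k (skip-injective v (trans eq (sym (skip-unskip v w w≢v))))

k≤skip₂ : ∀ v w k → k ≤ skip₂ v w k
k≤skip₂ v w k = ℕ.≤-trans (y≤skip (unskip v w) k) (y≤skip v _)

skip₂≤2+k : ∀ v w k → skip₂ v w k ≤ suc (suc k)
skip₂≤2+k v w k = ℕ.≤-trans (skip≤1+y v _) (s≤s (skip≤1+y (unskip v w) k))

v≤k⇒k<skip₂ : ∀ {v} w {k} → v ≤ k → k < skip₂ v w k
v≤k⇒k<skip₂ {v} w {k} v≤k = subst (k <_) (sym (a≤y⇒skip≡1+y (ℕ.≤-trans v≤k (y≤skip (unskip v w) k))))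
  (s≤s (y≤skip (unskip v w) k))

2≤v⇒skip₂-0≤1 : ∀ {v} w → 2 ≤ v → skip₂ v w 0 ≤ 1
2≤v⇒skip₂-0≤1 {v} w 2≤v = subst (_≤ 1) (sym (y<a⇒skip≡y (ℕ.<-≤-trans (s≤s (skip≤1+y (unskip v w) 0)) 2≤v)))
  (skip≤1+y (unskip v w) 0)

rotate : ℕ → ℕ → ℕ
rotate r i with suc i <? r
... | yes _ = suc i
... | no  _ = 0

rotate< : ∀ {r i} → i < r → rotate r i < r
rotate< {r} {i} i<r with suc i <? r
... | yes 1+i<r = 1+i<r
... | no  _     = ℕ.<-≤-trans (s≤s z≤n) i<r

rotate-injective : ∀ {r i j} → i < r → j < r → rotate r i ≡ rotate r j → i ≡ j
rotate-injective {r} {i} {j} i<r j<r eq with suc i <? r | suc j <? r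
... | yes _    | yes _    = ℕ.suc-injective eq
... | yes _    | no  _    = ⊥-elim (ℕ.1+n≢0 eq)
... | no  _    | yes _    = ⊥-elim (ℕ.1+n≢0 (sym eq))
... | no  i≮r  | no  j≮r  =
  ℕ.suc-injective (trans (ℕ.≤-antisym i<r (ℕ.≮⇒≥ i≮r)) (sym (ℕ.≤-antisym j<r (ℕ.≮⇒≥ j≮r))))

-- The i-th petal of the star around v is the hyperedge missing the i-th class other than v's; its
-- leaf is the (i + 1 mod r)-th number other than v and w, which never falls in that class.
rotation-derangement : ∀ {r} v w → 3 ≤ r → ∀ {i} → i < r → skip₂ v w (rotate r i) ⊓ r ≢ skip (v ⊓ r) i
rotation-derangement {r} v w 3≤r {i} i<r with suc i <? r | i <? v ⊓ r
... | yes 1+i<r | yes i<p = ℕ.>⇒≢ (begin-strict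
  skip (v ⊓ r) i             ≡⟨ y<a⇒skip≡y i<p ⟩
  i                          <⟨ ℕ.n<1+n i ⟩
  suc i                      ≤⟨ ℕ.⊓-glb (k≤skip₂ v w (suc i)) (ℕ.<⇒≤ 1+i<r) ⟩
  skip₂ v w (suc i) ⊓ r      ∎)
  where open ℕ.≤-Reasoning
... | yes 1+i<r | no  i≮p = ℕ.>⇒≢ (begin-strict
  skip (v ⊓ r) i             ≡⟨ a≤y⇒skip≡1+y (ℕ.≮⇒≥ i≮p) ⟩
  suc i                      <⟨ ℕ.⊓-glb (v≤k⇒k<skip₂ w (ℕ.m≤n⇒m≤1+n v≤i)) 1+i<r ⟩
  skip₂ v w (suc i) ⊓ r      ∎)
  where
  open ℕ.≤-Reasoning
  v≤i : v ≤ i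
  v≤i = ℕ.≮⇒≥ λ i<v → i≮p (ℕ.⊓-glb i<v i<r)
... | no  1+i≮r | yes i<p = ℕ.<⇒≢ (begin-strict
  skip₂ v w 0 ⊓ r            ≤⟨ ℕ.m⊓n≤m _ r ⟩
  skip₂ v w 0                ≤⟨ 2≤v⇒skip₂-0≤1 w (ℕ.≤-trans 2≤i (ℕ.<⇒≤ (ℕ.<-≤-trans i<p (ℕ.m⊓n≤m v r)))) ⟩
  1                          <⟨ ℕ.<-≤-trans (ℕ.n<1+n 1) 2≤i ⟩
  i                          ≡⟨ y<a⇒skip≡y i<p ⟨
  skip (v ⊓ r) i             ∎)
  where
  open ℕ.≤-Reasoning
  2≤i : 2 ≤ i
  2≤i = ℕ.≤-pred (ℕ.≤-trans 3≤r (ℕ.≮⇒≥ 1+i≮r))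
... | no  1+i≮r | no  i≮p = ℕ.<⇒≢ (begin-strict
  skip₂ v w 0 ⊓ r            ≤⟨ ℕ.m⊓n≤m _ r ⟩
  skip₂ v w 0                ≤⟨ skip₂≤2+k v w 0 ⟩
  2                          <⟨ ℕ.<-≤-trans (ℕ.n<1+n 2) 3≤r ⟩
  r                          ≡⟨ ℕ.≤-antisym i<r (ℕ.≮⇒≥ 1+i≮r) ⟨
  suc i                      ≡⟨ a≤y⇒skip≡1+y (ℕ.≮⇒≥ i≮p) ⟨
  skip (v ⊓ r) i             ∎)
  where open ℕ.≤-Reasoning

module Construction (r n : ℕ) (3≤r : 3 ≤ r) (2+r≤n : 2 + r ≤ n) where

  2≤r : 2 ≤ r
  2≤r = ℕ.≤-trans (ℕ.n≤1+n 2) 3≤r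

  1≤r : 1 ≤ r
  1≤r = ℕ.≤-trans (ℕ.n≤1+n 1) 2≤r

  class : Fin n → ℕ
  class x = toℕ x ⊓ r

  hyperedge : ℕ → Subset n
  hyperedge j = tabulate λ x → not ⌊ class x ≟ j ⌋

  ∈hyperedge⁺ : ∀ {x j} → class x ≢ j → x ∈ hyperedge j
  ∈hyperedge⁺ {x} {j} x≢j = Vec.lookup⇒[]= x (hyperedge j)
    (trans (Vec.lookup∘tabulate _ x) (Equivalence.to T-≡ (fromWitnessFalse x≢j)))

  ∈hyperedge⁻ : ∀ {x j} → x ∈ hyperedge j → class x ≢ j
  ∈hyperedge⁻ {x} {j} x∈ = toWitnessFalse (Equivalence.from T-≡
    (trans (sym (Vec.lookup∘tabulate _ x)) (Vec.[]=⇒lookup x∈)))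

  representative : ∀ {k} → k ≤ r → Fin n
  representative k≤r = fromℕ< (ℕ.≤-trans (s≤s (ℕ.m≤n⇒m≤1+n k≤r)) 2+r≤n)

  class-representative : ∀ {k} (k≤r : k ≤ r) → class (representative k≤r) ≡ k
  class-representative k≤r = trans (cong (_⊓ r) (Fin.toℕ-fromℕ< _)) (ℕ.m≤n⇒m⊓n≡m k≤r)

  representative∈hyperedge : ∀ {k j} (k≤r : k ≤ r) → k ≢ j → representative k≤r ∈ hyperedge j
  representative∈hyperedge k≤r k≢j = ∈hyperedge⁺ (k≢j ∘ trans (sym (class-representative k≤r)))

  distinct-classes⇒2≤∣hyperedge∣ : ∀ {a b j} (a≤r : a ≤ r) (b≤r : b ≤ r) → a ≢ b → a ≢ j → b ≢ j →
    2 ≤ ∣ hyperedge j ∣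
  distinct-classes⇒2≤∣hyperedge∣ a≤r b≤r a≢b a≢j b≢j = x≢y⇒2≤∣p∣
    (λ eq → a≢b (trans (sym (class-representative a≤r)) (trans (cong class eq) (class-representative b≤r))))
    (representative∈hyperedge a≤r a≢j) (representative∈hyperedge b≤r b≢j)

  2≤∣hyperedge∣ : ∀ j → 2 ≤ ∣ hyperedge j ∣
  2≤∣hyperedge∣ zero          = distinct-classes⇒2≤∣hyperedge∣ 1≤r 2≤r (λ ()) (λ ()) (λ ())
  2≤∣hyperedge∣ (suc zero)    = distinct-classes⇒2≤∣hyperedge∣ z≤n 2≤r (λ ()) (λ ()) (λ ())
  2≤∣hyperedge∣ (suc (suc j)) = distinct-classes⇒2≤∣hyperedge∣ z≤n 1≤r (λ ()) (λ ()) (λ ())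

  hyperedge-injective : ∀ {i j} → i ≤ r → hyperedge i ≡ hyperedge j → i ≡ j
  hyperedge-injective {i} {j} i≤r eq with i ≟ j
  ... | yes i≡j = i≡j
  ... | no  i≢j = ⊥-elim (∈hyperedge⁻ (subst (_ ∈_) (sym eq) (representative∈hyperedge i≤r i≢j))
                                      (class-representative i≤r))

  hyperedgeAt : Fin (suc r) → Subset n
  hyperedgeAt = hyperedge ∘ toℕ

  hyperedges : List (Subset n)
  hyperedges = List.tabulate hyperedgeAt

  length-hyperedges : length hyperedges ≡ suc r
  length-hyperedges = List.length-tabulate hyperedgeAt

  position : Fin (suc r) → Fin (length hyperedges)
  position = cast (sym length-hyperedges)

  lookup-position : ∀ j → List.lookup hyperedges (position j) ≡ hyperedge (toℕ j)
  lookup-position = List.lookup-tabulate hyperedgeAt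

  position-injective : ∀ {i j} → position i ≡ position j → i ≡ j
  position-injective {i} {j} eq = Fin.toℕ-injective
    (trans (sym (Fin.toℕ-cast _ i)) (trans (cong toℕ eq) (Fin.toℕ-cast _ j)))

  hypergraph : Hypergraph n
  hypergraph = record
    { edges  = hyperedges
    ; unique = Unique.tabulate⁺ {f = hyperedgeAt} λ {i} eq →
                 Fin.toℕ-injective (hyperedge-injective (ℕ.≤-pred (Fin.toℕ<n i)) eq)
    ; big    = All.tabulate⁺ {f = hyperedgeAt} (2≤∣hyperedge∣ ∘ toℕ)
    }

  -- Every vertex misses the hyperedge of its own class.
  ¬ContainsBerge : ¬ ContainsBerge (star (suc (suc r))) hyperedges
  ¬ContainsBerge B with c , c∈all ← ContainsBerge⇒common-vertex (ℕ.≤-reflexive length-hyperedges) B =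
    ∈hyperedge⁻ (All.tabulate⁻ {f = hyperedgeAt} c∈all (fromℕ< (s≤s (ℕ.m⊓n≤n (toℕ c) r))))
                (sym (Fin.toℕ-fromℕ< _))

  otherClass : Fin n → Fin r → Fin (suc r)
  otherClass v i = fromℕ< (s≤s (ℕ.≤-trans (skip≤1+y (class v) (toℕ i)) (Fin.toℕ<n i)))

  ∈otherClass : ∀ {x v i} → class x ≢ skip (class v) (toℕ i) → x ∈ List.lookup hyperedges (position (otherClass v i))
  ∈otherClass {x} x≢ = subst (x ∈_) (sym (lookup-position _))
    (∈hyperedge⁺ λ eq → x≢ (trans eq (Fin.toℕ-fromℕ< _)))

  leaf< : ∀ (v w : Fin n) (i : Fin r) → skip₂ (toℕ v) (toℕ w) (rotate r (toℕ i)) < n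
  leaf< v w i = ℕ.≤-<-trans (skip₂≤2+k _ _ _) (ℕ.≤-trans (s≤s (s≤s (rotate< (Fin.toℕ<n i)))) 2+r≤n)

  leaf : Fin n → Fin n → Fin r → Fin n
  leaf v w i = fromℕ< (leaf< v w i)

  toℕ-leaf : ∀ (v w : Fin n) i → toℕ (leaf v w i) ≡ skip₂ (toℕ v) (toℕ w) (rotate r (toℕ i))
  toℕ-leaf v w i = Fin.toℕ-fromℕ< (leaf< v w i)

  leaf≢w : ∀ {v w} → w ≢ v → ∀ i → leaf v w i ≢ w
  leaf≢w w≢v i eq = skip₂≢w (w≢v ∘ Fin.toℕ-injective) _ (trans (sym (toℕ-leaf _ _ i)) (cong toℕ eq))

  starAround : (v w : Fin n) → BergeStar r hyperedges
  starAround v w = record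
    { centre              = v
    ; leaf                = leaf v w
    ; hyperedge           = position ∘ otherClass v
    ; leaf-injective      = λ {i} {j} eq → Fin.toℕ-injective (rotate-injective (Fin.toℕ<n i) (Fin.toℕ<n j)
                              (skip₂-injective _ _ (Fin.fromℕ<-injective _ _ (leaf< v w i) (leaf< v w j) eq)))
    ; leaf≢centre         = λ i eq → skip₂≢v _ _ _ (trans (sym (toℕ-leaf v w i)) (cong toℕ eq))
    ; hyperedge-injective = λ {i} {j} → Fin.toℕ-injective ∘ skip-injective (class v)
                              ∘ Fin.fromℕ<-injective _ _ _ _ ∘ position-injective
    ; centre∈hyperedge    = λ i → ∈otherClass (skip-≢ (class v) (toℕ i) ∘ sym)
    ; leaf∈hyperedge      = λ i → ∈otherClass (subst (λ k → k ⊓ r ≢ _) (sym (toℕ-leaf v w i))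
                              (rotation-derangement (toℕ v) (toℕ w) 3≤r (Fin.toℕ<n i)))
    }

  saturating : Saturating (suc r) hyperedges
  saturating X 2≤∣X∣ _ with w , v , w≢v , w∈X , v∈X ← 2≤∣p∣⇒distinct-members 2≤∣X∣ =
    BergeStar⇒ContainsBerge (BergeStar-∷ (starAround v w) v∈X w∈X w≢v (leaf≢w w≢v))

  saturated : Saturated (star (suc (suc r))) hypergraph
  saturated = ¬ContainsBerge , saturating


lemma2 : (t n : ℕ) → 5 ≤ t → t ≤ n →
    SatNumberIs n (star t) (t ∸ 1) × Graph.E (star t) ≡ t ∸ 1
lemma2 (suc (suc r)) n (s≤s (s≤s 3≤r)) t≤n =
  ((hypergraph , saturated , length-hyperedges) , λ H → saturated⇒≤length (s≤s 3≤r) t≤n H) , refl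
  where open Construction r n 3≤r t≤n
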